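{- Let $n\ge 0$ and let $p(x)$ be the term $\sum_{i\le n}a_ix^i$, where $a_0,\dots,a_n$ are terms (in $L$ expanded by division) not containing the variable $x$. Then there is a finite sequence of quantifier-free formulas $\theta_0,\dots,\theta_{m-1}$ such that $T\vdash A(x)\wedge p(x)>0\to\bigvee_{k<m}\theta_k$, where each $\theta_k$ is of one of the following forms: (i) $\lambda(p(x))=2^r\lambda(a_i)x^i$ for some $0\le i\le n$ and some integer $r$ with $-1\le r\le n$; (ii) $x^e=\dfrac{2^r\lambda(a_i)}{\lambda(-a_j)}$ or $x^e=\dfrac{2^r\lambda(-a_j)}{\lambda(a_i)}$, for some $e,i,j,r$ with $1\le e\le n$, $0\le i,j\le n$, and $-(n+1)\le r\le n+1$.
   Context: Let $L$ be the language with constant symbols $0,1$, binary function symbols $+,-,\times$, the binary relation $<$, a unary function symbol $\lambda$, a unary predicate $A$, and unary predicates $D_n$ for each integer $n\ge 1$. Let $T$ be the $L$-theory consisting of the axioms of real closed ordered fields together with: $\forall x(A(x)\to x>0)$; $\forall x,y(A(x)\to(A(y)\leftrightarrow A(xy)))$; $A(2)\wedge\forall x(1<x<2\to\neg A(x))$; $\forall x(x>0\to\exists y(A(y)\wedge y\le x<2y))$; for each $n\ge1$, $\forall x(D_n(x)\leftrightarrow\exists y(A(y)\wedge y^n=x))$; $\forall x(x\le 0\to\lambda(x)=0)$; $\forall x(x>0\to A(\lambda(x))\wedge\lambda(x)\le x<2\lambda(x))$. Here $2$ abbreviates $1+1$. The division symbol $/$ is a binary function symbol defined in $T$ by $x/y=z\leftrightarrow((y\neq0\wedge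 x=yz)\vee(y=0\wedge z=0))$. For an integer $r\ge0$, $2^r$ denotes the numeral $(1+1)^r$, and for $r<0$, $2^r$ denotes $1/2^{ -r}$. -}

module Defs where

open import Data.Nat as ℕ using (ℕ; zero; suc)
open import Data.Integer as ℤ using (ℤ; +_; -[1+_])
open import Data.Fin using (Fin; toℕ)
import Data.Fin
open import Data.Product using (Σ; _×_; _,_; ∃)
open import Data.Sum using (_⊎_)
open import Relation.Binary.PropositionalEquality using (_≡_; _≢_)
open import Relation.Nullary using (¬_)
open import Function.Bundles using (_⇔_)
open import Level using (0ℓ)

-- Syntax: terms of L expanded by the defined division symbol.
-- Variables are indexed by ℕ; the variable x of the paper is  var 0 .

data Term : Set where
  var  : ℕ → Term
  𝟘 𝟙  : Term
  _⊕_ _⊖_ _⊗_ _⊘_ : Term → Term → Term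
  lam  : Term → Term

infixl 6 _⊕_ _⊖_
infixl 7 _⊗_ _⊘_

xVar : Term
xVar = var 0

data Occurs (k : ℕ) : Term → Set where
  here  : Occurs k (var k)
  ⊕ˡ : ∀ {s t} → Occurs k s → Occurs k (s ⊕ t)
  ⊕ʳ : ∀ {s t} → Occurs k t → Occurs k (s ⊕ t)
  ⊖ˡ : ∀ {s t} → Occurs k s → Occurs k (s ⊖ t)
  ⊖ʳ : ∀ {s t} → Occurs k t → Occurs k (s ⊖ t)
  ⊗ˡ : ∀ {s t} → Occurs k s → Occurs k (s ⊗ t)
  ⊗ʳ : ∀ {s t} → Occurs k t → Occurs k (s ⊗ t)
  ⊘ˡ : ∀ {s t} → Occurs k s → Occurs k (s ⊘ t)
  ⊘ʳ : ∀ {s t} → Occurs k t → Occurs k (s ⊘ t)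
  lamᵒ : ∀ {t} → Occurs k t → Occurs k (lam t)

_^ᵗ_ : Term → ℕ → Term
t ^ᵗ zero  = 𝟙
t ^ᵗ suc k = (t ^ᵗ k) ⊗ t

𝟚 : Term
𝟚 = 𝟙 ⊕ 𝟙

two^ : ℤ → Term
two^ (+ r)      = 𝟚 ^ᵗ r
two^ (-[1+ r ]) = 𝟙 ⊘ (𝟚 ^ᵗ suc r)

polyTerm : (n : ℕ) → (Fin (suc n) → Term) → Term
polyTerm zero    a = a Data.Fin.zero ⊗ (xVar ^ᵗ 0)
polyTerm (suc n) a = polyTerm n (λ i → a (Data.Fin.inject₁ i))
                     ⊕ (a (Data.Fin.fromℕ (suc n)) ⊗ (xVar ^ᵗ suc n))

data Theta (n : ℕ) : Set where
  formI   : (i : Fin (suc n)) (r : ℤ) → -[1+ 0 ] ℤ.≤ r → r ℤ.≤ + n → Theta n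
  formIIa : (e : ℕ) → 1 ℕ.≤ e → e ℕ.≤ n → (i j : Fin (suc n)) (r : ℤ) →
            -[1+ n ] ℤ.≤ r → r ℤ.≤ + suc n → Theta n
  formIIb : (e : ℕ) → 1 ℕ.≤ e → e ℕ.≤ n → (i j : Fin (suc n)) (r : ℤ) →
            -[1+ n ] ℤ.≤ r → r ℤ.≤ + suc n → Theta n

neg : Term → Term
neg a = 𝟘 ⊖ a

thetaEq : {n : ℕ} → Theta n → (Fin (suc n) → Term) → Term × Term
thetaEq {n} (formI i r _ _) a =
  lam (polyTerm n a) , two^ r ⊗ lam (a i) ⊗ (xVar ^ᵗ toℕ i)
thetaEq (formIIa e _ _ i j r _ _) a =
  xVar ^ᵗ e , (two^ r ⊗ lam (a i)) ⊘ lam (neg (a j))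
thetaEq (formIIb e _ _ i j r _ _) a =
  xVar ^ᵗ e , (two^ r ⊗ lam (neg (a j))) ⊘ lam (a i)

sumWith : {C : Set} → C → (C → C → C) → (k : ℕ) → (Fin k → C) → C
sumWith z _+_ zero    f = z
sumWith z _+_ (suc k) f = f Data.Fin.zero + sumWith z _+_ k (λ i → f (Data.Fin.suc i))

powWith : {C : Set} → C → (C → C → C) → C → ℕ → C
powWith i _*_ x zero    = i
powWith i _*_ x (suc k) = powWith i _*_ x k * x

record ModelT : Set₁ where
  infixl 6 _+_ _-_
  infixl 7 _*_ _/_
  infix 4 _<_ _≤_
  field
    C   : Set
    O I : C
    _+_ _-_ _*_ : C → C → C
    _<_ : C → C → Set
    λf  : C → C
    A   : C → Set
    D   : ℕ → C → Set
    _/_ : C → C → C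

  _≤_ : C → C → Set
  x ≤ y = (x < y) ⊎ (x ≡ y)

  pow : C → ℕ → C
  pow = powWith I _*_

  two : C
  two = I + I

  field
    +-assoc : ∀ x y z → (x + y) + z ≡ x + (y + z)
    +-comm  : ∀ x y → x + y ≡ y + x
    +-idʳ   : ∀ x → x + O ≡ x
    -‿def   : ∀ x y → (x - y) + y ≡ x
    *-assoc : ∀ x y z → (x * y) * z ≡ x * (y * z)
    *-comm  : ∀ x y → x * y ≡ y * x
    *-idʳ   : ∀ x → x * I ≡ x
    distrib : ∀ x y z → x * (y + z) ≡ x * y + x * z
    O≢I     : O ≢ I
    inverse : ∀ x → x ≢ O → ∃ λ y → x * y ≡ I
    <-irrefl : ∀ x → ¬ (x < x)
    <-trans  : ∀ {x y z} → x < y → y < z → x < z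
    <-total  : ∀ x y → (x < y) ⊎ (x ≡ y) ⊎ (y < x)
    <-+      : ∀ {x y} z → x < y → x + z < y + z
    <-*      : ∀ {x y} → O < x → O < y → O < x * y
    sqrt     : ∀ x → O < x → ∃ λ y → y * y ≡ x
    oddRoot  : ∀ (k : ℕ) (c : Fin (2 ℕ.* k ℕ.+ 1) → C) →
               ∃ λ x → pow x (2 ℕ.* k ℕ.+ 1) + sumWith O _+_ (2 ℕ.* k ℕ.+ 1) (λ i → c i * pow x (toℕ i)) ≡ O
    /-def : ∀ x y → (y ≢ O × x ≡ y * (x / y)) ⊎ (y ≡ O × x / y ≡ O)
    A-pos   : ∀ x → A x → O < x
    A-mul   : ∀ x y → A x → (A y ⇔ A (x * y))
    A-two   : A two
    A-gap   : ∀ x → I < x → x < two → ¬ A x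
    A-dense : ∀ x → O < x → ∃ λ y → A y × y ≤ x × x < two * y
    D-def   : ∀ n → 1 ℕ.≤ n → ∀ x → (D n x ⇔ (∃ λ y → A y × pow y n ≡ x))
    λ-nonpos : ∀ x → x ≤ O → λf x ≡ O
    λ-pos    : ∀ x → O < x → A (λf x) × λf x ≤ x × x < two * λf x

  eval : (ℕ → C) → Term → C
  eval ρ (var k) = ρ k
  eval ρ 𝟘 = O
  eval ρ 𝟙 = I
  eval ρ (s ⊕ t) = eval ρ s + eval ρ t
  eval ρ (s ⊖ t) = eval ρ s - eval ρ t
  eval ρ (s ⊗ t) = eval ρ s * eval ρ t
  eval ρ (s ⊘ t) = eval ρ s / eval ρ t
  eval ρ (lam t) = λf (eval ρ t)

Sat : {n : ℕ} (M : ModelT) → (ℕ → ModelT.C M) → (Fin (suc n) → Term) → Theta n → Set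
Sat M ρ a θ with thetaEq θ a
... | (l , r) = ModelT.eval M ρ l ≡ ModelT.eval M ρ r

{-# OPTIONS --safe #-}
-- Let T = aᵢxⁱ be the largest monomial of p. Since λ commutes with multiplication
-- by elements of A, L = λ(T) = λ(aᵢ)xⁱ, and p ≤ 2ⁿT gives λ(p) < 2ⁿ⁺¹L. As A has
-- exactly one element in each interval [y, 2y), two elements of A within a factor
-- 2ᵏ of each other differ by a power 2ʳ with |r| < k. If L < 4λ(p) this compares
-- λ(p) with λ(aᵢ)xⁱ and gives (i). Otherwise 2p < T, so the least monomial −aⱼxʲ
-- is negative and cancels T up to a factor 2ⁿ⁺¹; then λ(aᵢ)xⁱ and λ(−aⱼ)xʲ differ by
-- 2ʳ with |r| ≤ n + 1, i ≠ j, and dividing by the smaller power of x gives (ii).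
module Submission where

open import Defs
open import Algebra.Bundles using (CommutativeRing)
open import Algebra.Structures using (IsCommutativeRing)
open import Algebra.Consequences.Propositional
  using (comm∧idʳ⇒id; comm∧invˡ⇒inv; comm∧distrˡ⇒distrʳ)
import Algebra.Properties.AbelianGroup as AbelianGroupProperties
import Algebra.Properties.CommutativeMonoid.Sum as SumProperties
import Algebra.Properties.CommutativeSemigroup as CommutativeSemigroupProperties
import Algebra.Properties.Ring as RingProperties
open import Data.Fin as Fin using (Fin; toℕ)
open import Data.Fin.Properties
  using (toℕ-inject₁; toℕ-fromℕ; toℕ-fromℕ<; toℕ≤pred[n]; toℕ<n; toℕ-injective)
open import Data.Integer as ℤ using (ℤ; -[1+_])
import Data.Integer.Properties as ℤ
open import Data.List using (List; allFin; map; _++_; cartesianProduct)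
import Data.List.Extrema as Extrema
open import Data.List.Membership.Propositional using (_∈_; lose)
open import Data.List.Membership.Propositional.Properties
  using (∈-allFin; ∈-map⁺; ∈-++⁺ˡ; ∈-++⁺ʳ; ∈-cartesianProduct⁺)
import Data.List.Relation.Unary.All as All
open import Data.List.Relation.Unary.Any using (Any)
open import Data.Nat as ℕ using (ℕ; zero; suc)
import Data.Nat.Properties as ℕ
open import Data.Product using (Σ; ∃; _×_; _,_; proj₁; proj₂)
open import Data.Sum using (_⊎_; inj₁; inj₂)
open import Data.Vec.Functional using (removeAt)
open import Function using (_∘_)
open import Function.Bundles using (module Equivalence)
open import Level using (0ℓ)
open import Relation.Binary.Bundles using (StrictPartialOrder; TotalOrder)
import Relation.Binary.Construct.StrictToNonStrict as StrictToNonStrict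
open import Relation.Binary.Definitions using (Trichotomous; tri<; tri≈; tri>)
open import Relation.Binary.PropositionalEquality
import Relation.Binary.Reasoning.StrictPartialOrder as OrderReasoning
open import Relation.Binary.Structures using (IsStrictTotalOrder)
open import Relation.Nullary using (¬_; contradiction)

module Properties (M : ModelT) where
  open ModelT M hiding (+-assoc; +-comm; *-assoc; *-comm; distrib)

  -- Chosen so that eval ρ (neg t) is definitionally - eval ρ t.
  infix 8 -_
  -_ : C → C
  - x = O - x

  isCommutativeRing : IsCommutativeRing _≡_ _+_ _*_ -_ O I
  isCommutativeRing = record
    { isRing = record
      { +-isAbelianGroup = record
        { isGroup = record
          { isMonoid = record
            { isSemigroup = record
              { isMagma = record { isEquivalence = isEquivalence ; ∙-cong = cong₂ _+_ }
              ; assoc = ModelT.+-assoc M }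
            ; identity = comm∧idʳ⇒id (ModelT.+-comm M) +-idʳ }
          ; inverse = comm∧invˡ⇒inv (ModelT.+-comm M) (-‿def O)
          ; ⁻¹-cong = cong (λ x → - x) }
        ; comm = ModelT.+-comm M }
      ; *-cong = cong₂ _*_
      ; *-assoc = ModelT.*-assoc M
      ; *-identity = comm∧idʳ⇒id (ModelT.*-comm M) *-idʳ
      ; distrib = ModelT.distrib M , comm∧distrˡ⇒distrʳ (ModelT.*-comm M) (ModelT.distrib M) }
    ; *-comm = ModelT.*-comm M }

  commutativeRing : CommutativeRing 0ℓ 0ℓ
  commutativeRing = record { isCommutativeRing = isCommutativeRing }

  open CommutativeRing commutativeRing public
    using ( +-assoc; +-comm; +-identityˡ; +-identityʳ; -‿inverseˡ; -‿inverseʳ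
          ; *-assoc; *-comm; *-identityˡ; *-identityʳ; distribˡ; distribʳ
          ; zeroʳ; +-commutativeMonoid)
  open RingProperties (CommutativeRing.ring commutativeRing) public
    using (-‿distribˡ-*; -‿distribʳ-*; -‿involutive; -0#≈0#)

  two*x≡x+x : ∀ x → two * x ≡ x + x
  two*x≡x+x x = trans (distribʳ x I I) (cong₂ _+_ (*-identityˡ x) (*-identityˡ x))

  -- Order

  <-isStrictTotalOrder : IsStrictTotalOrder _≡_ _<_
  <-isStrictTotalOrder = record
    { isStrictPartialOrder = record
      { isEquivalence = isEquivalence
      ; irrefl = λ { refl → <-irrefl _ }
      ; trans = <-trans
      ; <-resp-≈ = resp₂ _<_ }
    ; compare = compare }
    where
    compare : Trichotomous _≡_ _<_
    compare x y with <-total x y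
    ... | inj₁ x<y = tri< x<y (λ { refl → <-irrefl x x<y }) (λ y<x → <-irrefl x (<-trans x<y y<x))
    ... | inj₂ (inj₁ refl) = tri≈ (<-irrefl x) refl (<-irrefl x)
    ... | inj₂ (inj₂ y<x) = tri> (λ x<y → <-irrefl x (<-trans x<y y<x)) (λ { refl → <-irrefl x y<x }) y<x

  strictPartialOrder : StrictPartialOrder 0ℓ 0ℓ 0ℓ
  strictPartialOrder = record
    { isStrictPartialOrder = IsStrictTotalOrder.isStrictPartialOrder <-isStrictTotalOrder }

  totalOrder : TotalOrder 0ℓ 0ℓ 0ℓ
  totalOrder = record
    { isTotalOrder = StrictToNonStrict.isTotalOrder _≡_ _<_ <-isStrictTotalOrder }

  ≤-refl : ∀ {x} → x ≤ x
  ≤-refl = TotalOrder.refl totalOrder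

  ≤-trans : ∀ {x y z} → x ≤ y → y ≤ z → x ≤ z
  ≤-trans = TotalOrder.trans totalOrder

  total : ∀ x y → x ≤ y ⊎ y ≤ x
  total = TotalOrder.total totalOrder
  open StrictToNonStrict _≡_ _<_ public using (<⇒≤)

  <-≤-trans : ∀ {x y z} → x < y → y ≤ z → x < z
  <-≤-trans = StrictToNonStrict.<-≤-trans _≡_ _<_ <-trans (resp₂ _<_ .proj₁)

  ≤-<-trans : ∀ {x y z} → x ≤ y → y < z → x < z
  ≤-<-trans = StrictToNonStrict.≤-<-trans _≡_ _<_ sym <-trans (resp₂ _<_ .proj₂)

  <⇒≱ : ∀ {x y} → x < y → ¬ (y ≤ x)
  <⇒≱ x<y y≤x = <-irrefl _ (<-≤-trans x<y y≤x)

  <⇒≢ : ∀ {x y} → x < y → x ≢ y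
  <⇒≢ x<y refl = <-irrefl _ x<y

  <⊎≥ : ∀ x y → x < y ⊎ y ≤ x
  <⊎≥ x y with <-total x y
  ... | inj₁ x<y = inj₁ x<y
  ... | inj₂ (inj₁ x≡y) = inj₂ (inj₂ (sym x≡y))
  ... | inj₂ (inj₂ y<x) = inj₂ (inj₁ y<x)

  +-monoˡ-< : ∀ {x y} z → x < y → x + z < y + z
  +-monoˡ-< = <-+

  +-monoʳ-< : ∀ {x y} z → x < y → z + x < z + y
  +-monoʳ-< {x} {y} z x<y = subst₂ _<_ (+-comm x z) (+-comm y z) (<-+ z x<y)

  +-monoˡ-≤ : ∀ {x y} z → x ≤ y → x + z ≤ y + z
  +-monoˡ-≤ z (inj₁ x<y) = inj₁ (+-monoˡ-< z x<y)
  +-monoˡ-≤ z (inj₂ refl) = ≤-refl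

  +-monoʳ-≤ : ∀ {x y} z → x ≤ y → z + x ≤ z + y
  +-monoʳ-≤ z (inj₁ x<y) = inj₁ (+-monoʳ-< z x<y)
  +-monoʳ-≤ z (inj₂ refl) = ≤-refl

  +-cancelˡ-< : ∀ {x y} z → z + x < z + y → x < y
  +-cancelˡ-< {x} {y} z z+x<z+y = subst₂ _<_ (cancel x) (cancel y) (+-monoʳ-< (- z) z+x<z+y)
    where
    cancel : ∀ u → - z + (z + u) ≡ u
    cancel u = trans (sym (+-assoc (- z) z u)) (trans (cong (_+ u) (-‿inverseˡ z)) (+-identityˡ u))

  neg-antimono-< : ∀ {x y} → x < y → - y < - x
  neg-antimono-< {x} {y} x<y =
    subst₂ _<_ (trans (cong (x +_) (+-comm (- y) (- x))) (cancel x (- y))) (cancel y (- x))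
      (+-monoˡ-< (- y + - x) x<y)
    where
    cancel : ∀ u v → u + (- u + v) ≡ v
    cancel u v = trans (sym (+-assoc u (- u) v)) (trans (cong (_+ v) (-‿inverseʳ u)) (+-identityˡ v))

  neg-antimono-≤ : ∀ {x y} → x ≤ y → - y ≤ - x
  neg-antimono-≤ (inj₁ x<y) = inj₁ (neg-antimono-< x<y)
  neg-antimono-≤ (inj₂ refl) = ≤-refl

  neg-cancel-≤ : ∀ {x y} → - y ≤ - x → x ≤ y
  neg-cancel-≤ {x} {y} -y≤-x = subst₂ _≤_ (-‿involutive x) (-‿involutive y) (neg-antimono-≤ -y≤-x)

  *-monoʳ-<-pos : ∀ {x y} z → O < z → x < y → z * x < z * y
  *-monoʳ-<-pos {x} {y} z 0<z x<y =
    subst₂ _<_ (+-identityˡ (z * x)) z*[y-x]+z*x≡z*y (+-monoˡ-< (z * x) (<-* 0<z 0<y-x))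
    where
    0<y-x : O < y + - x
    0<y-x = subst₂ _<_ (-‿inverseʳ x) refl (+-monoˡ-< (- x) x<y)
    z*[y-x]+z*x≡z*y : z * (y + - x) + z * x ≡ z * y
    z*[y-x]+z*x≡z*y = begin
      z * (y + - x) + z * x   ≡⟨ sym (distribˡ z (y + - x) x) ⟩
      z * (y + - x + x)       ≡⟨ cong (z *_) (+-assoc y (- x) x) ⟩
      z * (y + (- x + x))     ≡⟨ cong (λ u → z * (y + u)) (-‿inverseˡ x) ⟩
      z * (y + O)             ≡⟨ cong (z *_) (+-identityʳ y) ⟩
      z * y                   ∎
      where open ≡-Reasoning

  *-monoˡ-<-pos : ∀ {x y} z → O < z → x < y → x * z < y * z
  *-monoˡ-<-pos {x} {y} z 0<z x<y = subst₂ _<_ (*-comm z x) (*-comm z y) (*-monoʳ-<-pos z 0<z x<y)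

  *-monoʳ-≤-pos : ∀ {x y} z → O < z → x ≤ y → z * x ≤ z * y
  *-monoʳ-≤-pos z 0<z (inj₁ x<y) = inj₁ (*-monoʳ-<-pos z 0<z x<y)
  *-monoʳ-≤-pos z 0<z (inj₂ refl) = ≤-refl

  *-monoˡ-≤-pos : ∀ {x y} z → O < z → x ≤ y → x * z ≤ y * z
  *-monoˡ-≤-pos z 0<z (inj₁ x<y) = inj₁ (*-monoˡ-<-pos z 0<z x<y)
  *-monoˡ-≤-pos z 0<z (inj₂ refl) = ≤-refl

  *-cancelˡ-<-pos : ∀ {x y} z → O < z → z * x < z * y → x < y
  *-cancelˡ-<-pos {x} {y} z 0<z zx<zy with <⊎≥ x y
  ... | inj₁ x<y = x<y
  ... | inj₂ y≤x = contradiction (*-monoʳ-≤-pos z 0<z y≤x) (<⇒≱ zx<zy)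

  *-cancelˡ-≡-pos : ∀ {x y} z → O < z → z * x ≡ z * y → x ≡ y
  *-cancelˡ-≡-pos {x} {y} z 0<z zx≡zy with <-total x y
  ... | inj₁ x<y = contradiction zx≡zy (<⇒≢ (*-monoʳ-<-pos z 0<z x<y))
  ... | inj₂ (inj₁ x≡y) = x≡y
  ... | inj₂ (inj₂ y<x) = contradiction (sym zx≡zy) (<⇒≢ (*-monoʳ-<-pos z 0<z y<x))

  *-cancelʳ-≡-pos : ∀ {x y} z → O < z → x * z ≡ y * z → x ≡ y
  *-cancelʳ-≡-pos {x} {y} z 0<z xz≡yz =
    *-cancelˡ-≡-pos z 0<z (trans (*-comm z x) (trans xz≡yz (*-comm y z)))

  pos-*-cancelˡ : ∀ {x y} → O < x → O < x * y → O < y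
  pos-*-cancelˡ {x} 0<x 0<xy = *-cancelˡ-<-pos x 0<x (subst (_< _) (sym (zeroʳ x)) 0<xy)

  x+y<0⇒x<-y : ∀ {x y} → x + y < O → x < - y
  x+y<0⇒x<-y {x} {y} x+y<0 = subst₂ _<_ x+y-y≡x (+-identityˡ (- y)) (+-monoˡ-< (- y) x+y<0)
    where
    x+y-y≡x : x + y + - y ≡ x
    x+y-y≡x = trans (+-assoc x y (- y)) (trans (cong (x +_) (-‿inverseʳ y)) (+-identityʳ x))

  0<x+y⇒-x<y : ∀ {x y} → O < x + y → - x < y
  0<x+y⇒-x<y {x} {y} 0<x+y = subst₂ _<_ (+-identityʳ (- x)) -x+[x+y]≡y (+-monoʳ-< (- x) 0<x+y)
    where
    -x+[x+y]≡y : - x + (x + y) ≡ y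
    -x+[x+y]≡y = trans (sym (+-assoc (- x) x y)) (trans (cong (_+ y) (-‿inverseˡ x)) (+-identityˡ y))

  0<1 : O < I
  0<1 with <-total O I
  ... | inj₁ 0<1 = 0<1
  ... | inj₂ (inj₁ 0≡1) = contradiction 0≡1 O≢I
  ... | inj₂ (inj₂ 1<0) = subst (O <_) -1*-1≡1 (<-* 0<-1 0<-1)
    where
    0<-1 : O < - I
    0<-1 = subst (_< - I) -0#≈0# (neg-antimono-< 1<0)
    -1*-1≡1 : - I * - I ≡ I
    -1*-1≡1 = trans (sym (-‿distribˡ-* I (- I))) (trans (cong -_ (*-identityˡ (- I))) (-‿involutive I))

  0<2 : O < two
  0<2 = subst (_< two) (+-identityʳ O) (<-trans (+-monoˡ-< O 0<1) (+-monoʳ-< I 0<1))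

  x<2*x : ∀ {x} → O < x → x < two * x
  x<2*x {x} 0<x = subst₂ _<_ (+-identityˡ x) (sym (two*x≡x+x x)) (+-monoˡ-< x 0<x)

  x≤x+y : ∀ x {y} → O ≤ y → x ≤ x + y
  x≤x+y x 0≤y = subst (_≤ x + _) (+-identityʳ x) (+-monoʳ-≤ x 0≤y)

  module ≤-Reasoning = OrderReasoning strictPartialOrder

  -- Powers and division

  pow-pos : ∀ {x} k → O < x → O < pow x k
  pow-pos zero 0<x = 0<1
  pow-pos (suc k) 0<x = <-* (pow-pos k 0<x) 0<x

  pow-+ : ∀ x m k → pow x (m ℕ.+ k) ≡ pow x m * pow x k
  pow-+ x zero k = sym (*-identityˡ (pow x k))
  pow-+ x (suc m) k = begin
    pow x (m ℕ.+ k) * x       ≡⟨ cong (_* x) (pow-+ x m k) ⟩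
    pow x m * pow x k * x     ≡⟨ *-assoc (pow x m) (pow x k) x ⟩
    pow x m * (pow x k * x)   ≡⟨ cong (pow x m *_) (*-comm (pow x k) x) ⟩
    pow x m * (x * pow x k)   ≡⟨ sym (*-assoc (pow x m) x (pow x k)) ⟩
    pow x m * x * pow x k     ∎
    where open ≡-Reasoning

  *-pow-cancel : ∀ {x u v} e k → O < x → u * pow x k ≡ v * pow x (e ℕ.+ k) → u ≡ v * pow x e
  *-pow-cancel {x} {u} {v} e k 0<x u*xᵏ≡v*xᵉ⁺ᵏ = *-cancelʳ-≡-pos (pow x k) (pow-pos k 0<x) (begin
    u * pow x k                 ≡⟨ u*xᵏ≡v*xᵉ⁺ᵏ ⟩
    v * pow x (e ℕ.+ k)         ≡⟨ cong (v *_) (pow-+ x e k) ⟩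
    v * (pow x e * pow x k)     ≡⟨ sym (*-assoc v (pow x e) (pow x k)) ⟩
    v * pow x e * pow x k       ∎)
    where open ≡-Reasoning

  2^[1+n]*x≡2^n*x+2^n*x : ∀ n x → pow two (suc n) * x ≡ pow two n * x + pow two n * x
  2^[1+n]*x≡2^n*x+2^n*x n x = begin
    pow two n * two * x       ≡⟨ *-assoc (pow two n) two x ⟩
    pow two n * (two * x)     ≡⟨ cong (pow two n *_) (two*x≡x+x x) ⟩
    pow two n * (x + x)       ≡⟨ distribˡ (pow two n) x x ⟩
    pow two n * x + pow two n * x ∎
    where open ≡-Reasoning

  x≤2^n*x : ∀ n {x} → O ≤ x → x ≤ pow two n * x
  x≤2^n*x zero {x} _ = inj₂ (sym (*-identityˡ x))
  x≤2^n*x (suc n) {x} 0≤x = begin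
    x                             ≤⟨ x≤2^n*x n 0≤x ⟩
    pow two n * x                 ≤⟨ x≤x+y _ (≤-trans 0≤x (x≤2^n*x n 0≤x)) ⟩
    pow two n * x + pow two n * x ≡⟨ sym (2^[1+n]*x≡2^n*x+2^n*x n x) ⟩
    pow two (suc n) * x           ∎
    where open ≤-Reasoning

  *-/-cancel : ∀ x {y} → O < y → y * (x / y) ≡ x
  *-/-cancel x {y} 0<y with /-def x y
  ... | inj₁ (_ , x≡y*[x/y]) = sym x≡y*[x/y]
  ... | inj₂ (y≡0 , _) = contradiction (sym y≡0) (<⇒≢ 0<y)

  /-unique : ∀ {x y z} → O < y → y * z ≡ x → z ≡ x / y
  /-unique {x} 0<y yz≡x = *-cancelˡ-≡-pos _ 0<y (trans yz≡x (sym (*-/-cancel x 0<y)))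

  twoPow : ℤ → C
  twoPow (ℤ.+ r) = pow two r
  twoPow -[1+ r ] = I / pow two (suc r)

  twoPow-inverseˡ : ∀ z → twoPow (ℤ.- z) * twoPow z ≡ I
  twoPow-inverseˡ (ℤ.+ zero) = *-identityˡ I
  twoPow-inverseˡ (ℤ.+ suc r) = trans (*-comm _ (pow two (suc r))) (*-/-cancel I (pow-pos (suc r) 0<2))
  twoPow-inverseˡ -[1+ r ] = *-/-cancel I (pow-pos (suc r) 0<2)

  twoPow-flip : ∀ z {x y} → x ≡ twoPow z * y → y ≡ twoPow (ℤ.- z) * x
  twoPow-flip z {x} {y} x≡2ᶻy = begin
    y                                ≡⟨ sym (*-identityˡ y) ⟩
    I * y                            ≡⟨ cong (_* y) (sym (twoPow-inverseˡ z)) ⟩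
    twoPow (ℤ.- z) * twoPow z * y    ≡⟨ *-assoc (twoPow (ℤ.- z)) (twoPow z) y ⟩
    twoPow (ℤ.- z) * (twoPow z * y)  ≡⟨ cong (twoPow (ℤ.- z) *_) (sym x≡2ᶻy) ⟩
    twoPow (ℤ.- z) * x               ∎
    where open ≡-Reasoning

  -- The subgroup A and the function λ

  A-* : ∀ {x y} → A x → A y → A (x * y)
  A-* {x} {y} Ax Ay = Equivalence.to (A-mul x y Ax) Ay

  A-1 : A I
  A-1 = Equivalence.from (A-mul two I A-two) (subst A (sym (*-identityʳ two)) A-two)

  A-pow : ∀ {x} k → A x → A (pow x k)
  A-pow zero Ax = A-1
  A-pow (suc k) Ax = A-* (A-pow k Ax) Ax

  -- Otherwise x/y would be an element of A strictly between 1 and 2.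
  A-y≤x<2y⇒x≡y : ∀ {x y} → A x → A y → y ≤ x → x < two * y → x ≡ y
  A-y≤x<2y⇒x≡y _ _ (inj₂ y≡x) _ = sym y≡x
  A-y≤x<2y⇒x≡y {x} {y} Ax Ay (inj₁ y<x) x<2y = contradiction Aq (A-gap q 1<q q<2)
    where
    0<y : O < y
    0<y = A-pos y Ay
    y⁻¹ : C
    y⁻¹ = proj₁ (inverse y (<⇒≢ 0<y ∘ sym))
    q : C
    q = x * y⁻¹
    y*q≡x : y * q ≡ x
    y*q≡x = begin
      y * (x * y⁻¹)   ≡⟨ cong (y *_) (*-comm x y⁻¹) ⟩
      y * (y⁻¹ * x)   ≡⟨ sym (*-assoc y y⁻¹ x) ⟩
      y * y⁻¹ * x     ≡⟨ cong (_* x) (proj₂ (inverse y (<⇒≢ 0<y ∘ sym))) ⟩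
      I * x           ≡⟨ *-identityˡ x ⟩
      x               ∎
      where open ≡-Reasoning
    Aq : A q
    Aq = Equivalence.from (A-mul y q Ay) (subst A (sym y*q≡x) Ax)
    1<q : I < q
    1<q = *-cancelˡ-<-pos y 0<y (subst₂ _<_ (sym (*-identityʳ y)) (sym y*q≡x) y<x)
    q<2 : q < two
    q<2 = *-cancelˡ-<-pos y 0<y (subst₂ _<_ (sym y*q≡x) (*-comm two y) x<2y)

  λ-unique : ∀ {x u} → A u → u ≤ x → x < two * u → λf x ≡ u
  λ-unique {x} {u} Au u≤x x<2u with λ-pos x (<-≤-trans (A-pos u Au) u≤x)
  ... | Aλx , λx≤x , x<2λx with total u (λf x)
  ...   | inj₁ u≤λx = A-y≤x<2y⇒x≡y Aλx Au u≤λx (≤-<-trans λx≤x x<2u)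
  ...   | inj₂ λx≤u = sym (A-y≤x<2y⇒x≡y Au Aλx λx≤u (≤-<-trans u≤x x<2λx))

  λ-pos-≡ : ∀ {x u} → O < x → λf x ≡ u → A u × u ≤ x × x < two * u
  λ-pos-≡ 0<x refl = λ-pos _ 0<x

  0<λ : ∀ {x} → O < x → O < λf x
  0<λ 0<x = A-pos _ (proj₁ (λ-pos _ 0<x))

  λ-*-A : ∀ {x u} → O < x → A u → λf (x * u) ≡ λf x * u
  λ-*-A {x} {u} 0<x Au with λ-pos x 0<x
  ... | Aλx , λx≤x , x<2λx =
    λ-unique (A-* Aλx Au) (*-monoˡ-≤-pos u 0<u λx≤x)
      (subst (x * u <_) (*-assoc two (λf x) u) (*-monoˡ-<-pos u 0<u x<2λx))
    where
    0<u : O < u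
    0<u = A-pos u Au

  A-ratio-ℕ : ∀ t {x y} → A x → A y → y ≤ x → x < pow two (suc t) * y →
             ∃ λ r → r ℕ.≤ t × x ≡ pow two r * y
  A-ratio-ℕ t {x} {y} Ax Ay y≤x x<2ᵗ⁺¹y with <⊎≥ x (two * y)
  ... | inj₁ x<2y = 0 , ℕ.z≤n , trans (A-y≤x<2y⇒x≡y Ax Ay y≤x x<2y) (sym (*-identityˡ y))
  A-ratio-ℕ zero {x} {y} Ax Ay y≤x x<2y | inj₂ 2y≤x =
    contradiction 2y≤x (<⇒≱ (subst (λ c → x < c * y) (*-identityˡ two) x<2y))
  A-ratio-ℕ (suc t) {x} {y} Ax Ay y≤x x<2ᵗ⁺²y | inj₂ 2y≤x
    with A-ratio-ℕ t Ax (A-* A-two Ay) 2y≤x (subst (x <_) (*-assoc (pow two (suc t)) two y) x<2ᵗ⁺²y)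
  ... | r , r≤t , x≡2ʳ[2y] = suc r , ℕ.s≤s r≤t , trans x≡2ʳ[2y] (sym (*-assoc (pow two r) two y))

  A-ratio-ℤ : ∀ p q {x y} → A x → A y → x < pow two (suc p) * y → y < pow two (suc q) * x →
            ∃ λ z → ℤ.- (ℤ.+ q) ℤ.≤ z × z ℤ.≤ ℤ.+ p × x ≡ twoPow z * y
  A-ratio-ℤ p q {x} {y} Ax Ay x<2ᵖ⁺¹y y<2^q⁺¹x with <⊎≥ x y
  ... | inj₂ y≤x =
    let r , r≤p , x≡2ʳy = A-ratio-ℕ p Ax Ay y≤x x<2ᵖ⁺¹y
    in ℤ.+ r , ℤ.neg-≤-pos , ℤ.+≤+ r≤p , x≡2ʳy
  ... | inj₁ x<y =
    let r , r≤q , y≡2ʳx = A-ratio-ℕ q Ay Ax (<⇒≤ x<y) y<2^q⁺¹x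
    in ℤ.- ℤ.+ r , ℤ.neg-mono-≤ (ℤ.+≤+ r≤q) , ℤ.neg-≤-pos , twoPow-flip (ℤ.+ r) y≡2ʳx

  -- Finite sums

  open SumProperties +-commutativeMonoid public using (sum; sum-cong-≗; sum-init-last; sum-remove)
  open AbelianGroupProperties (CommutativeRing.+-abelianGroup commutativeRing) using (⁻¹-∙-comm)

  sum-neg : ∀ {n} (f : Fin n → C) → sum (-_ ∘ f) ≡ - sum f
  sum-neg {zero} f = sym -0#≈0#
  sum-neg {suc n} f = trans (cong (- f Fin.zero +_) (sum-neg (f ∘ Fin.suc))) (⁻¹-∙-comm _ _)

  x+sum≤2^n*x : ∀ {n x} (f : Fin n → C) → O ≤ x → (∀ i → f i ≤ x) → x + sum f ≤ pow two n * x
  x+sum≤2^n*x {zero} {x} f _ _ = inj₂ (trans (+-identityʳ x) (sym (*-identityˡ x)))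
  x+sum≤2^n*x {suc n} {x} f 0≤x f≤x = begin
    x + (f Fin.zero + sum (f ∘ Fin.suc))
      ≤⟨ +-monoʳ-≤ x (+-monoˡ-≤ _ (f≤x Fin.zero)) ⟩
    x + (x + sum (f ∘ Fin.suc))
      ≤⟨ +-monoʳ-≤ x (x+sum≤2^n*x (f ∘ Fin.suc) 0≤x (f≤x ∘ Fin.suc)) ⟩
    x + pow two n * x
      ≤⟨ +-monoˡ-≤ _ (x≤2^n*x n 0≤x) ⟩
    pow two n * x + pow two n * x
      ≡⟨ 2^[1+n]*x≡2^n*x+2^n*x n x ⟨
    pow two (suc n) * x ∎
    where open ≤-Reasoning

  2^n*x≤x+sum : ∀ {n x} (f : Fin n → C) → x ≤ O → (∀ i → x ≤ f i) → pow two n * x ≤ x + sum f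
  2^n*x≤x+sum {n} {x} f x≤0 x≤f = neg-cancel-≤ (subst₂ _≤_ -x+sum[-f]≡-[x+sum] 2ⁿ[-x]≡-[2ⁿx]
    (x+sum≤2^n*x (-_ ∘ f) (subst (_≤ - x) -0#≈0# (neg-antimono-≤ x≤0)) (neg-antimono-≤ ∘ x≤f)))
    where
    -x+sum[-f]≡-[x+sum] : - x + sum (-_ ∘ f) ≡ - (x + sum f)
    -x+sum[-f]≡-[x+sum] = trans (cong (- x +_) (sum-neg f)) (⁻¹-∙-comm x (sum f))
    2ⁿ[-x]≡-[2ⁿx] : pow two n * - x ≡ - (pow two n * x)
    2ⁿ[-x]≡-[2ⁿx] = sym (-‿distribʳ-* (pow two n) x)

  module _ {n} (f : Fin (suc n) → C) where
    open Extrema totalOrder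

    maximum : ∃ λ i → ∀ j → f j ≤ f i
    maximum = argmax f Fin.zero (allFin _) ,
              λ j → All.lookup (f[xs]≤f[argmax] Fin.zero (allFin _)) (∈-allFin j)

    minimum : ∃ λ i → ∀ j → f i ≤ f j
    minimum = argmin f Fin.zero (allFin _) ,
              λ j → All.lookup (f[argmin]≤f[xs] Fin.zero (allFin _)) (∈-allFin j)

module Evaluation (M : ModelT) (ρ : ℕ → ModelT.C M) where
  open ModelT M hiding (+-assoc; +-comm; *-assoc; *-comm; distrib)
  open Properties M

  eval-^ᵗ : ∀ s k → eval ρ (s ^ᵗ k) ≡ pow (eval ρ s) k
  eval-^ᵗ s zero = refl
  eval-^ᵗ s (suc k) = cong (_* eval ρ s) (eval-^ᵗ s k)

  eval-two^ : ∀ z → eval ρ (two^ z) ≡ twoPow z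
  eval-two^ (ℤ.+ r) = eval-^ᵗ 𝟚 r
  eval-two^ -[1+ r ] = cong (I /_) (eval-^ᵗ 𝟚 (suc r))

  eval-polyTerm : ∀ m (b : Fin (suc m) → Term) →
                  eval ρ (polyTerm m b) ≡ sum (λ i → eval ρ (b i) * pow (ρ 0) (toℕ i))
  eval-polyTerm zero b = sym (+-identityʳ _)
  eval-polyTerm (suc m) b = begin
    eval ρ (polyTerm m (b ∘ Fin.inject₁)) + eval ρ (b last) * eval ρ (xVar ^ᵗ suc m)
      ≡⟨ cong₂ _+_ (eval-polyTerm m (b ∘ Fin.inject₁))
                   (cong (eval ρ (b last) *_) (eval-^ᵗ xVar (suc m))) ⟩
    sum (λ i → monomial (Fin.inject₁ i) (toℕ i)) + monomial last (suc m)
      ≡⟨ cong₂ _+_ (sum-cong-≗ (λ i → cong (monomial (Fin.inject₁ i)) (toℕ-inject₁ i)))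
                   (cong (monomial last) (toℕ-fromℕ (suc m))) ⟨
    sum (λ i → monomial (Fin.inject₁ i) (toℕ (Fin.inject₁ i))) + monomial last (toℕ last)
      ≡⟨ sum-init-last (λ i → monomial i (toℕ i)) ⟨
    sum (λ i → monomial i (toℕ i)) ∎
    where
    open ≡-Reasoning
    last : Fin (suc (suc m))
    last = Fin.fromℕ (suc m)
    monomial : Fin (suc (suc m)) → ℕ → C
    monomial i k = eval ρ (b i) * pow (ρ 0) k

module Polynomial (M : ModelT) (ρ : ℕ → ModelT.C M) {n : ℕ} (a : Fin (suc n) → Term) where
  open ModelT M hiding (+-assoc; +-comm; *-assoc; *-comm; distrib)
  open Properties M
  open Evaluation M ρ
  open CommutativeSemigroupProperties (CommutativeRing.+-commutativeSemigroup commutativeRing) using (interchange)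

  x : C
  x = ρ 0

  c : Fin (suc n) → C
  c i = eval ρ (a i)

  t : Fin (suc n) → C
  t i = c i * pow x (toℕ i)

  p : C
  p = eval ρ (polyTerm n a)

  p≡t+rest : ∀ i → p ≡ t i + sum (removeAt t i)
  p≡t+rest i = trans (eval-polyTerm n a) (sum-remove t)

  satI : ∀ i z lo hi → λf p ≡ twoPow z * (λf (c i) * pow x (toℕ i)) → ∃ (Sat M ρ a)
  satI i z lo hi Λ≡2ᶻL = formI i z lo hi , (begin
    λf p
      ≡⟨ Λ≡2ᶻL ⟩
    twoPow z * (λf (c i) * pow x (toℕ i))
      ≡⟨ *-assoc (twoPow z) (λf (c i)) (pow x (toℕ i)) ⟨
    twoPow z * λf (c i) * pow x (toℕ i)
      ≡⟨ cong₂ (λ u v → u * λf (c i) * v) (eval-two^ z) (eval-^ᵗ xVar (toℕ i)) ⟨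
    eval ρ (two^ z) * λf (c i) * eval ρ (xVar ^ᵗ toℕ i) ∎)
    where open ≡-Reasoning

  satIIa : ∀ e 1≤e e≤n i j z lo hi → O < - c j →
           λf (- c j) * pow x e ≡ twoPow z * λf (c i) → ∃ (Sat M ρ a)
  satIIa e 1≤e e≤n i j z lo hi 0<-cⱼ βxᵉ≡2ᶻα =
    formIIa e 1≤e e≤n i j z lo hi , trans (eval-^ᵗ xVar e)
      (/-unique (0<λ 0<-cⱼ) (trans βxᵉ≡2ᶻα (cong (_* λf (c i)) (sym (eval-two^ z)))))

  satIIb : ∀ e 1≤e e≤n i j z lo hi → O < c i →
           λf (c i) * pow x e ≡ twoPow z * λf (- c j) → ∃ (Sat M ρ a)
  satIIb e 1≤e e≤n i j z lo hi 0<cᵢ αxᵉ≡2ᶻβ =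
    formIIb e 1≤e e≤n i j z lo hi , trans (eval-^ᵗ xVar e)
      (/-unique (0<λ 0<cᵢ) (trans αxᵉ≡2ᶻβ (cong (_* λf (- c j)) (sym (eval-two^ z)))))

  toℕ∸toℕ≤n : ∀ (k l : Fin (suc n)) → toℕ k ℕ.∸ toℕ l ℕ.≤ n
  toℕ∸toℕ≤n k l = ℕ.≤-trans (ℕ.m∸n≤m (toℕ k) (toℕ l)) (toℕ≤pred[n] k)

  -- Dividing by the smaller of the two powers of x leaves an equation of shape (ii).
  dyadic-monomials⇒II : ∀ i j z → ℤ.- ℤ.+ n ℤ.≤ z → z ℤ.≤ ℤ.+ suc n →
    O < x → O < c i → O < - c j →
    λf (c i) * pow x (toℕ i) ≡ twoPow z * (λf (- c j) * pow x (toℕ j)) → ∃ (Sat M ρ a)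
  dyadic-monomials⇒II i j z lo hi 0<x 0<cᵢ 0<-cⱼ αxⁱ≡2ᶻβxʲ with ℕ.<-cmp (toℕ i) (toℕ j)
  ... | tri< i<j _ _ =
    satIIa e (ℕ.m<n⇒0<n∸m i<j) (toℕ∸toℕ≤n j i) i j (ℤ.- z) -[1+n]≤-z -z≤1+n 0<-cⱼ
      (twoPow-flip z α≡2ᶻβxᵉ)
    where
    e : ℕ
    e = toℕ j ℕ.∸ toℕ i
    α≡2ᶻβxᵉ : λf (c i) ≡ twoPow z * (λf (- c j) * pow x e)
    α≡2ᶻβxᵉ = trans (*-pow-cancel e (toℕ i) 0<x (trans αxⁱ≡2ᶻβxʲ (begin
      twoPow z * (λf (- c j) * pow x (toℕ j))       ≡⟨ sym (*-assoc (twoPow z) _ _) ⟩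
      twoPow z * λf (- c j) * pow x (toℕ j)
        ≡⟨ cong (λ k → twoPow z * λf (- c j) * pow x k) (ℕ.m∸n+n≡m (ℕ.<⇒≤ i<j)) ⟨
      twoPow z * λf (- c j) * pow x (e ℕ.+ toℕ i)   ∎)))
      (*-assoc (twoPow z) _ _)
      where open ≡-Reasoning
    -[1+n]≤-z : -[1+ n ] ℤ.≤ ℤ.- z
    -[1+n]≤-z = ℤ.neg-mono-≤ hi
    -z≤1+n : ℤ.- z ℤ.≤ ℤ.+ suc n
    -z≤1+n = ℤ.≤-trans (subst (ℤ.- z ℤ.≤_) (ℤ.neg-involutive _) (ℤ.neg-mono-≤ lo))
                       (ℤ.+≤+ (ℕ.n≤1+n n))
  ... | tri≈ _ i≡j _ =
    contradiction (subst (λ k → O < - c k) (sym (toℕ-injective i≡j)) 0<-cⱼ) (<⇒≱ -cᵢ<0 ∘ inj₁)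
    where
    -cᵢ<0 : - c i < O
    -cᵢ<0 = subst (- c i <_) -0#≈0# (neg-antimono-< 0<cᵢ)
  ... | tri> _ _ j<i =
    satIIb e (ℕ.m<n⇒0<n∸m j<i) (toℕ∸toℕ≤n i j) i j z -[1+n]≤z hi 0<cᵢ (sym 2ᶻβ≡αxᵉ)
    where
    e : ℕ
    e = toℕ i ℕ.∸ toℕ j
    2ᶻβ≡αxᵉ : twoPow z * λf (- c j) ≡ λf (c i) * pow x e
    2ᶻβ≡αxᵉ = *-pow-cancel e (toℕ j) 0<x (begin
      twoPow z * λf (- c j) * pow x (toℕ j)      ≡⟨ *-assoc (twoPow z) _ _ ⟩
      twoPow z * (λf (- c j) * pow x (toℕ j))    ≡⟨ sym αxⁱ≡2ᶻβxʲ ⟩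
      λf (c i) * pow x (toℕ i)
        ≡⟨ cong (λ k → λf (c i) * pow x k) (ℕ.m∸n+n≡m (ℕ.<⇒≤ j<i)) ⟨
      λf (c i) * pow x (e ℕ.+ toℕ j)             ∎)
      where open ≡-Reasoning
    -[1+n]≤z : -[1+ n ] ℤ.≤ z
    -[1+n]≤z = ℤ.≤-trans (ℤ.neg-mono-≤ (ℤ.+≤+ (ℕ.n≤1+n n))) lo

  module _ (x∈A : A x) (0<p : O < p) (i₀ : Fin (suc n)) (t≤T : ∀ j → t j ≤ t i₀) where
    0<x : O < x
    0<x = A-pos x x∈A

    T : C
    T = t i₀

    0<T : O < T
    0<T with <⊎≥ O T
    ... | inj₁ 0<T = 0<T
    ... | inj₂ T≤0 = contradiction p≤0 (<⇒≱ 0<p)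
      where
      open ≤-Reasoning
      p≤0 : p ≤ O
      p≤0 = begin
        p                    ≡⟨ eval-polyTerm n a ⟩
        sum t                ≡⟨ +-identityˡ (sum t) ⟨
        O + sum t            ≤⟨ x+sum≤2^n*x t ≤-refl (λ j → ≤-trans (t≤T j) T≤0) ⟩
        pow two (suc n) * O  ≡⟨ zeroʳ (pow two (suc n)) ⟩
        O                    ∎

    0<c₀ : O < c i₀
    0<c₀ = pos-*-cancelˡ (pow-pos (toℕ i₀) 0<x) (subst (O <_) (*-comm (c i₀) _) 0<T)

    L : C
    L = λf (c i₀) * pow x (toℕ i₀)

    L-bounds : A L × L ≤ T × T < two * L
    L-bounds = λ-pos-≡ 0<T (λ-*-A 0<c₀ (A-pow (toℕ i₀) x∈A))

    A-L : A L
    A-L = proj₁ L-bounds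

    L≤T : L ≤ T
    L≤T = proj₁ (proj₂ L-bounds)

    T<2L : T < two * L
    T<2L = proj₂ (proj₂ L-bounds)

    Λ : C
    Λ = λf p

    A-Λ : A Λ
    A-Λ = proj₁ (λ-pos p 0<p)

    Λ≤p : Λ ≤ p
    Λ≤p = proj₁ (proj₂ (λ-pos p 0<p))

    p<2Λ : p < two * Λ
    p<2Λ = proj₂ (proj₂ (λ-pos p 0<p))

    Λ<2ⁿ⁺¹L : Λ < pow two (suc n) * L
    Λ<2ⁿ⁺¹L = begin-strict
      Λ                       ≤⟨ Λ≤p ⟩
      p                       ≡⟨ p≡t+rest i₀ ⟩
      T + sum (removeAt t i₀) ≤⟨ x+sum≤2^n*x (removeAt t i₀) (<⇒≤ 0<T) (t≤T ∘ Fin.punchIn i₀) ⟩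
      pow two n * T           <⟨ *-monoʳ-<-pos _ (pow-pos n 0<2) T<2L ⟩
      pow two n * (two * L)   ≡⟨ *-assoc (pow two n) two L ⟨
      pow two (suc n) * L     ∎
      where open ≤-Reasoning

    caseI : L < pow two 2 * Λ → ∃ (Sat M ρ a)
    caseI L<4Λ =
      let z , lo , hi , Λ≡2ᶻL = A-ratio-ℤ n 1 A-Λ A-L Λ<2ⁿ⁺¹L L<4Λ
      in satI i₀ z lo hi Λ≡2ᶻL

    -- Now 2p < T, so the least monomial m = t j must nearly cancel T.
    module _ (4Λ≤L : pow two 2 * Λ ≤ L) (j : Fin (suc n)) (m≤t : ∀ k → t j ≤ t k) where
      m : C
      m = t j

      R : C
      R = sum (removeAt t i₀)

      2p<T : two * p < T
      2p<T = begin-strict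
        two * p            <⟨ *-monoʳ-<-pos two 0<2 p<2Λ ⟩
        two * (two * Λ)    ≡⟨ *-assoc two two Λ ⟨
        two * two * Λ      ≡⟨ cong (λ u → u * two * Λ) (*-identityˡ two) ⟨
        pow two 2 * Λ      ≤⟨ 4Λ≤L ⟩
        L                  ≤⟨ L≤T ⟩
        T                  ∎
        where open ≤-Reasoning

      m≤0 : m ≤ O
      m≤0 with <⊎≥ O m
      ... | inj₂ m≤0 = m≤0
      ... | inj₁ 0<m = contradiction T≤p (<⇒≱ (<-trans (x<2*x 0<p) 2p<T))
        where
        0≤R : O ≤ R
        0≤R = subst₂ _≤_ (zeroʳ _) (+-identityˡ R)
          (2^n*x≤x+sum (removeAt t i₀) ≤-refl (λ k → ≤-trans (inj₁ 0<m) (m≤t (Fin.punchIn i₀ k))))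
        T≤p : T ≤ p
        T≤p = subst (T ≤_) (sym (p≡t+rest i₀)) (x≤x+y T 0≤R)

      T+2ⁿm≤p : T + pow two n * m ≤ p
      T+2ⁿm≤p = subst (T + pow two n * m ≤_) (sym (p≡t+rest i₀)) (+-monoʳ-≤ T (begin
        pow two n * m  ≤⟨ 2^n*x≤x+sum (removeAt t i₀) m≤0 (m≤t ∘ Fin.punchIn i₀) ⟩
        m + R          ≤⟨ +-monoˡ-≤ R m≤0 ⟩
        O + R          ≡⟨ +-identityˡ R ⟩
        R              ∎))
        where open ≤-Reasoning

      T<2ⁿ⁺¹U : T < pow two (suc n) * - m
      T<2ⁿ⁺¹U = subst (T <_) (-‿distribʳ-* (pow two (suc n)) m)
        (x+y<0⇒x<-y (+-cancelˡ-< T (begin-strict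
          T + (T + pow two (suc n) * m)
            ≡⟨ cong (λ u → T + (T + u)) (2^[1+n]*x≡2^n*x+2^n*x n m) ⟩
          T + (T + (pow two n * m + pow two n * m))
            ≡⟨ +-assoc T T _ ⟨
          T + T + (pow two n * m + pow two n * m)
            ≡⟨ interchange T T _ _ ⟩
          T + pow two n * m + (T + pow two n * m)
            ≡⟨ two*x≡x+x _ ⟨
          two * (T + pow two n * m)
            ≤⟨ *-monoʳ-≤-pos two 0<2 T+2ⁿm≤p ⟩
          two * p
            <⟨ 2p<T ⟩
          T
            ≡⟨ +-identityʳ T ⟨
          T + O ∎)))
        where open ≤-Reasoning

      U<2ⁿT : - m < pow two n * T
      U<2ⁿT = 0<x+y⇒-x<y (<-≤-trans 0<p (begin
        p                             ≡⟨ p≡t+rest j ⟩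
        m + sum (removeAt t j)        ≡⟨ cong (m +_) (+-identityˡ _) ⟨
        m + (O + sum (removeAt t j))  ≤⟨ +-monoʳ-≤ m (+-monoˡ-≤ _ (<⇒≤ 0<T)) ⟩
        m + (T + sum (removeAt t j))
          ≤⟨ +-monoʳ-≤ m (x+sum≤2^n*x (removeAt t j) (<⇒≤ 0<T) (t≤T ∘ Fin.punchIn j)) ⟩
        m + pow two n * T             ∎))
        where open ≤-Reasoning

      0<U : O < - m
      0<U = pos-*-cancelˡ (pow-pos (suc n) 0<2) (<-trans 0<T T<2ⁿ⁺¹U)

      U≡-cⱼxʲ : - m ≡ - c j * pow x (toℕ j)
      U≡-cⱼxʲ = -‿distribˡ-* (c j) (pow x (toℕ j))

      0<-cⱼ : O < - c j
      0<-cⱼ = pos-*-cancelˡ (pow-pos (toℕ j) 0<x) (subst (O <_) (trans U≡-cⱼxʲ (*-comm (- c j) _)) 0<U)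

      L′ : C
      L′ = λf (- c j) * pow x (toℕ j)

      L′-bounds : A L′ × L′ ≤ - m × - m < two * L′
      L′-bounds = λ-pos-≡ 0<U (trans (cong λf U≡-cⱼxʲ) (λ-*-A 0<-cⱼ (A-pow (toℕ j) x∈A)))

      L<2ⁿ⁺²L′ : L < pow two (suc (suc n)) * L′
      L<2ⁿ⁺²L′ = begin-strict
        L                             ≤⟨ L≤T ⟩
        T                             <⟨ T<2ⁿ⁺¹U ⟩
        pow two (suc n) * - m         <⟨ *-monoʳ-<-pos _ (pow-pos (suc n) 0<2) (proj₂ (proj₂ L′-bounds)) ⟩
        pow two (suc n) * (two * L′)  ≡⟨ *-assoc (pow two (suc n)) two L′ ⟨
        pow two (suc (suc n)) * L′    ∎
        where open ≤-Reasoning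

      L′<2ⁿ⁺¹L : L′ < pow two (suc n) * L
      L′<2ⁿ⁺¹L = begin-strict
        L′                     ≤⟨ proj₁ (proj₂ L′-bounds) ⟩
        - m                    <⟨ U<2ⁿT ⟩
        pow two n * T          <⟨ *-monoʳ-<-pos _ (pow-pos n 0<2) T<2L ⟩
        pow two n * (two * L)  ≡⟨ *-assoc (pow two n) two L ⟨
        pow two (suc n) * L    ∎
        where open ≤-Reasoning

      caseII : ∃ (Sat M ρ a)
      caseII =
        let z , lo , hi , L≡2ᶻL′ =
              A-ratio-ℤ (suc n) n A-L (proj₁ L′-bounds) L<2ⁿ⁺²L′ L′<2ⁿ⁺¹L
        in dyadic-monomials⇒II i₀ j z lo hi 0<x 0<c₀ 0<-cⱼ L≡2ᶻL′

    satisfiable-with-max : ∃ (Sat M ρ a)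
    satisfiable-with-max with <⊎≥ L (pow two 2 * Λ)
    ... | inj₁ L<4Λ = caseI L<4Λ
    ... | inj₂ 4Λ≤L = let j , m≤t = minimum t in caseII 4Λ≤L j m≤t

  satisfiable : A x → O < p → ∃ (Sat M ρ a)
  satisfiable x∈A 0<p = let i₀ , t≤T = maximum t in satisfiable-with-max x∈A 0<p i₀ t≤T

-- Enumerating the formulas of shapes (i) and (ii)

Interval : ℕ → ℕ → Set
Interval a b = Σ ℤ λ r → -[1+ a ] ℤ.≤ r × r ℤ.≤ ℤ.+ b

interval-≡ : ∀ {a b} {u v : Interval a b} → proj₁ u ≡ proj₁ v → u ≡ v
interval-≡ {u = r , p , q} {v = .r , p′ , q′} refl =
  cong₂ (λ p q → r , p , q) (ℤ.≤-irrelevant p p′) (ℤ.≤-irrelevant q q′)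

module _ {a b : ℕ} where
  negative : Fin (suc a) → Interval a b
  negative k = -[1+ toℕ k ] , ℤ.-≤- (toℕ≤pred[n] k) , ℤ.-≤+

  nonNegative : Fin (suc b) → Interval a b
  nonNegative k = ℤ.+ toℕ k , ℤ.-≤+ , ℤ.+≤+ (toℕ≤pred[n] k)

  negatives : List (Interval a b)
  negatives = map negative (allFin (suc a))

  nonNegatives : List (Interval a b)
  nonNegatives = map nonNegative (allFin (suc b))

  intervals : List (Interval a b)
  intervals = negatives ++ nonNegatives

  ∈-intervals : ∀ u → u ∈ intervals
  ∈-intervals (-[1+ s ] , ℤ.-≤- s≤a , _) = ∈-++⁺ˡ (subst (_∈ negatives)
    (interval-≡ (cong -[1+_] (toℕ-fromℕ< (ℕ.s≤s s≤a))))
    (∈-map⁺ negative (∈-allFin (Fin.fromℕ< (ℕ.s≤s s≤a)))))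
  ∈-intervals (ℤ.+ s , _ , ℤ.+≤+ s≤b) = ∈-++⁺ʳ negatives (subst (_∈ nonNegatives)
    (interval-≡ (cong ℤ.+_ (toℕ-fromℕ< (ℕ.s≤s s≤b))))
    (∈-map⁺ nonNegative (∈-allFin (Fin.fromℕ< (ℕ.s≤s s≤b)))))

Exponent : ℕ → Set
Exponent n = Σ ℕ λ e → 1 ℕ.≤ e × e ℕ.≤ n

exponent-≡ : ∀ {n} {u v : Exponent n} → proj₁ u ≡ proj₁ v → u ≡ v
exponent-≡ {u = e , p , q} {v = .e , p′ , q′} refl =
  cong₂ (λ p q → e , p , q) (ℕ.≤-irrelevant p p′) (ℕ.≤-irrelevant q q′)

module _ {n : ℕ} where
  positive : Fin n → Exponent n
  positive d = suc (toℕ d) , ℕ.s≤s ℕ.z≤n , toℕ<n d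

  exponents : List (Exponent n)
  exponents = map positive (allFin n)

  ∈-exponents : ∀ e → e ∈ exponents
  ∈-exponents (suc d , _ , d<n) = subst (_∈ exponents)
    (exponent-≡ (cong suc (toℕ-fromℕ< d<n)))
    (∈-map⁺ positive (∈-allFin (Fin.fromℕ< d<n)))

module _ {n : ℕ} where
  CodeI CodeII : Set
  CodeI = Fin (suc n) × Interval 0 n
  CodeII = Exponent n × Fin (suc n) × Fin (suc n) × Interval n (suc n)

  decodeI : CodeI → Theta n
  decodeI (i , r , lo , hi) = formI i r lo hi

  decodeIIa decodeIIb : CodeII → Theta n
  decodeIIa ((e , 1≤e , e≤n) , i , j , r , lo , hi) = formIIa e 1≤e e≤n i j r lo hi
  decodeIIb ((e , 1≤e , e≤n) , i , j , r , lo , hi) = formIIb e 1≤e e≤n i j r lo hi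

  codesII : List CodeII
  codesII = cartesianProduct exponents
              (cartesianProduct (allFin _) (cartesianProduct (allFin _) intervals))

  ∈-codesII : ∀ c → c ∈ codesII
  ∈-codesII (e , i , j , u) = ∈-cartesianProduct⁺ (∈-exponents e)
    (∈-cartesianProduct⁺ (∈-allFin i) (∈-cartesianProduct⁺ (∈-allFin j) (∈-intervals u)))

  thetasI thetasIIa thetasIIb allTheta : List (Theta n)
  thetasI = map decodeI (cartesianProduct (allFin _) intervals)
  thetasIIa = map decodeIIa codesII
  thetasIIb = map decodeIIb codesII
  allTheta = thetasI ++ thetasIIa ++ thetasIIb

  ∈-allTheta : ∀ θ → θ ∈ allTheta
  ∈-allTheta (formI i r lo hi) = ∈-++⁺ˡ {ys = thetasIIa ++ thetasIIb}
    (∈-map⁺ decodeI (∈-cartesianProduct⁺ (∈-allFin i) (∈-intervals (r , lo , hi))))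
  ∈-allTheta (formIIa e 1≤e e≤n i j r lo hi) = ∈-++⁺ʳ thetasI (∈-++⁺ˡ {ys = thetasIIb}
    (∈-map⁺ decodeIIa (∈-codesII ((e , 1≤e , e≤n) , i , j , r , lo , hi))))
  ∈-allTheta (formIIb e 1≤e e≤n i j r lo hi) = ∈-++⁺ʳ thetasI (∈-++⁺ʳ thetasIIa
    (∈-map⁺ decodeIIb (∈-codesII ((e , 1≤e , e≤n) , i , j , r , lo , hi))))

lemma3p9 : (n : ℕ) (a : Fin (suc n) → Term) →
    (∀ i → ¬ Occurs 0 (a i)) →
    Σ (List (Theta n)) λ θs →
    (M : ModelT) (ρ : ℕ → ModelT.C M) →
    ModelT.A M (ρ 0) →
    ModelT._<_ M (ModelT.O M) (ModelT.eval M ρ (polyTerm n a)) →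
    Any (Sat M ρ a) θs
lemma3p9 n a _ = allTheta , λ M ρ x∈A 0<p →
  let θ , θ-holds = Polynomial.satisfiable M ρ a x∈A 0<p
  in lose (∈-allTheta θ) θ-holds
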